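{- A graph $G$ is a convex geometry in the $P_3$ convexity if and only if $G$ is a forest of stars (every connected component of $G$ is a star).
   Context: Graphs are finite and simple. In the $P_3$ convexity on a graph $G$, a set $S\subseteq V(G)$ is convex if every vertex lying on a path with three vertices (two edges, not necessarily induced) whose endpoints are in $S$ belongs to $S$; equivalently, every vertex $x\notin S$ has at most one neighbor in $S$. The convex hull $H(S)$ of $S\subseteq V(G)$ is the smallest convex set containing $S$. A vertex $x$ of a convex set $S$ is an extreme vertex of $S$ if $S\setminus\{x\}$ is convex; $\mathit{ext}(S)$ denotes the set of extreme vertices of $S$. $G$ is a convex geometry (with respect to the convexity) if every convex set $S\subseteq V(G)$ satisfies $S=H(\mathit{ext}(S))$. -}

module Defs where

open import Data.Nat using (ℕ)
open import Data.Fin using (Fin)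
open import Data.Fin.Subset using (Subset; _∈_; _∉_; _⊆_; _-_)
open import Data.Product using (Σ; _×_; ∃)
open import Data.Sum using (_⊎_)
open import Data.Empty using (⊥)
open import Relation.Nullary using (¬_)
open import Relation.Binary.PropositionalEquality using (_≡_; _≢_)
open import Relation.Binary.Construct.Closure.ReflexiveTransitive using (Star)

record Graph (n : ℕ) : Set₁ where
  field
    Adj     : Fin n → Fin n → Set
    sym     : ∀ {u v} → Adj u v → Adj v u
    irrefl  : ∀ {u} → ¬ Adj u u
    adj?    : ∀ u v → Adj u v ⊎ ¬ Adj u v

open Graph public

module _ {n : ℕ} (G : Graph n) where

  Convex : Subset n → Set
  Convex S = ∀ a x b → a ≢ b → Adj G a x → Adj G x b → a ∈ S → b ∈ S → x ∈ S

  Ext : Subset n → Fin n → Set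
  Ext S x = x ∈ S × Convex (S - x)

  IsConvexHull : (Fin n → Set) → Subset n → Set
  IsConvexHull A T =
    (∀ x → A x → x ∈ T) × Convex T ×
    (∀ (C : Subset n) → Convex C → (∀ x → A x → x ∈ C) → T ⊆ C)

  ConvexGeometry : Set
  ConvexGeometry = ∀ (S : Subset n) → Convex S → IsConvexHull (Ext S) S

  Connected : Fin n → Fin n → Set
  Connected = Star (Adj G)

  ForestOfStars : Set
  ForestOfStars = ∀ v → Σ (Fin n) λ c →
    Connected v c ×
    (∀ u → Connected v u → u ≡ c ⊎ Adj G c u) ×
    (∀ u w → Connected v u → Adj G u w → u ≡ c ⊎ w ≡ c)

-- In the P₃ convexity a vertex of a convex set S is extreme exactly when it has at most
-- one neighbour in S.  Both conditions of the theorem are equivalent to every edge having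
-- an endpoint of degree one.
--
-- If every edge has such a leaf, a vertex with two neighbours in S is the centre of a star
-- whose leaves in S are extreme, so it lies in every convex set containing ext(S).
-- Conversely, the hull K of a set B arises by repeatedly adjoining vertices with two
-- neighbours in the current set, so ext(K) ⊆ B.  In a convex geometry K = H(ext K), hence
-- B ⊆ C whenever C is convex and every vertex of B outside C has two neighbours in B.
-- With C = ∅ this excludes triangles and the five vertices of a walk a–u–w–b closed up by
-- a common neighbour of a and b; with C = {a, b} it excludes such a walk whose ends have
-- no common neighbour.  So no edge has two endpoints of degree at least two.
module Submission where

open import Defs
open import Data.Nat using (ℕ)
open import Data.Fin using (Fin; _≟_; #_)
open import Data.Fin.Properties using (any?)
open import Data.Fin.Subset using (Subset; _∈_; _∉_; _⊆_; _⊂_; _⊃_; _─_; _-_; _∪_; ⁅_⁆; inside; outside)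
  renaming (⊥ to ∅)
open import Data.Fin.Subset.Properties
  using (_∈?_; ∉⊥; x∈⁅x⁆; x∈⁅y⁆⇒x≡y; x∈p∧x≢y⇒x∈p-y; p⊆p∪q; q⊆p∪q; x∈p∪q⁻; ⊆-trans; p─q⊆p)
open import Data.Fin.Subset.Induction using (Acc; acc; ⊃-wellFounded)
open import Data.Vec using (_∷_)
import Data.Vec.Base as Vec
open import Data.List using (List; []; _∷_)
open import Data.List.Relation.Unary.Any using (here; there)
open import Data.List.Relation.Unary.All as All using (All; []; _∷_)
open import Data.List.Membership.Propositional using () renaming (_∈_ to _∈ₗ_)
open import Data.List.Membership.Propositional.Properties using (∈-lookup)
open import Data.Product using (Σ-syntax; ∃; _×_; _,_; proj₁; proj₂)
open import Data.Sum using (_⊎_; inj₁; inj₂; [_,_]; map₂)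
open import Data.Empty using (⊥; ⊥-elim)
open import Function using (_∘_; id)
open import Relation.Nullary using (¬_; Dec; yes; no)
open import Relation.Nullary.Decidable using (_×-dec_; ¬?; fromSum; decidable-stable)
open import Relation.Unary using (Decidable)
open import Relation.Binary.Definitions using (_Respects_)
open import Relation.Binary.PropositionalEquality as ≡ using (_≡_; _≢_; refl; trans; subst; ≢-sym)
open import Relation.Binary.Construct.Closure.ReflexiveTransitive using (ε; _◅_)

x∈p─q⇒x∉q : ∀ {n} {x : Fin n} (p q : Subset n) → x ∈ p ─ q → x ∉ q
x∈p─q⇒x∉q (inside ∷ p)  (outside ∷ q) Vec.here        ()
x∈p─q⇒x∉q (_ ∷ p)       (_ ∷ q)       (Vec.there x∈) (Vec.there x∈q) = x∈p─q⇒x∉q p q x∈ x∈q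
x∈p─q⇒x∉q (outside ∷ p) (inside ∷ q)  ()              Vec.here

x∉p-x : ∀ {n} {x : Fin n} (p : Subset n) → x ∉ p - x
x∉p-x {x = x} p x∈ = x∈p─q⇒x∉q p ⁅ x ⁆ x∈ (x∈⁅x⁆ x)

module _ {n : ℕ} where

  fromList : List (Fin n) → Subset n
  fromList []       = ∅
  fromList (x ∷ xs) = ⁅ x ⁆ ∪ fromList xs

  ∈-fromList⁺ : ∀ {x xs} → x ∈ₗ xs → x ∈ fromList xs
  ∈-fromList⁺ {x} {y ∷ xs} (here refl) = p⊆p∪q (fromList xs) (x∈⁅x⁆ x)
  ∈-fromList⁺ {x} {y ∷ xs} (there x∈xs) = q⊆p∪q ⁅ y ⁆ (fromList xs) (∈-fromList⁺ x∈xs)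

  ∈-fromList⁻ : ∀ {x} xs → x ∈ fromList xs → x ∈ₗ xs
  ∈-fromList⁻ []       x∈ = ⊥-elim (∉⊥ x∈)
  ∈-fromList⁻ (y ∷ xs) x∈ with x∈p∪q⁻ ⁅ y ⁆ (fromList xs) x∈
  ... | inj₁ x∈⁅y⁆ = here (x∈⁅y⁆⇒x≡y y x∈⁅y⁆)
  ... | inj₂ x∈xs  = there (∈-fromList⁻ xs x∈xs)

module _ {n : ℕ} (G : Graph n) where

  adj-dec : ∀ u v → Dec (Adj G u v)
  adj-dec u v = fromSum (Graph.adj? G u v)

  adj⇒≢ : ∀ {u v} → Adj G u v → u ≢ v
  adj⇒≢ uv refl = irrefl G uv

  TwoNeighboursIn : (Fin n → Set) → Fin n → Set
  TwoNeighboursIn P x = Σ[ p ∈ Fin n ] Σ[ q ∈ Fin n ] p ≢ q × Adj G x p × Adj G x q × P p × P q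

  twoNeighboursIn-mono : ∀ {P Q : Fin n → Set} → (∀ {y} → P y → Q y) →
                         ∀ {x} → TwoNeighboursIn P x → TwoNeighboursIn Q x
  twoNeighboursIn-mono P⊆Q (p , q , p≢q , xp , xq , Pp , Pq) = p , q , p≢q , xp , xq , P⊆Q Pp , P⊆Q Pq

  twoNeighboursIn? : ∀ {P : Fin n → Set} → Decidable P → Decidable (TwoNeighboursIn P)
  twoNeighboursIn? P? x = any? λ p → any? λ q →
    ¬? (p ≟ q) ×-dec adj-dec x p ×-dec adj-dec x q ×-dec P? p ×-dec P? q

  convex⁺ : ∀ {S} → (∀ {x} → TwoNeighboursIn (_∈ S) x → x ∈ S) → Convex G S
  convex⁺ closed a x b a≢b ax xb a∈S b∈S = closed (a , b , a≢b , sym G ax , xb , a∈S , b∈S)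

  convex⁻ : ∀ {S x} → Convex G S → TwoNeighboursIn (_∈ S) x → x ∈ S
  convex⁻ convS (p , q , p≢q , xp , xq , p∈S , q∈S) = convS p _ q p≢q (sym G xp) xq p∈S q∈S

  ext⁻ : ∀ {S x} → Ext G S x → ¬ TwoNeighboursIn (_∈ S) x
  ext⁻ {S} {x} (_ , convS-x) (p , q , p≢q , xp , xq , p∈S , q∈S) =
    x∉p-x S (convS-x p x q p≢q (sym G xp) xq (outside-x xp p∈S) (outside-x xq q∈S))
    where
    outside-x : ∀ {y} → Adj G x y → y ∈ S → y ∈ S - x
    outside-x xy y∈S = x∈p∧x≢y⇒x∈p-y y∈S (adj⇒≢ (sym G xy))

  ext⁺ : ∀ {S x} → Convex G S → x ∈ S → ¬ TwoNeighboursIn (_∈ S) x → Ext G S x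
  ext⁺ {S} {x} convS x∈S ¬two = x∈S , convex⁺ closed
    where
    closed : ∀ {y} → TwoNeighboursIn (_∈ S - x) y → y ∈ S - x
    closed {y} two with y ≟ x
    ... | yes refl = ⊥-elim (¬two (twoNeighboursIn-mono (p─q⊆p S ⁅ x ⁆) two))
    ... | no y≢x   = x∈p∧x≢y⇒x∈p-y (convex⁻ convS (twoNeighboursIn-mono (p─q⊆p S ⁅ x ⁆) two)) y≢x

  Generated : Subset n → Subset n → Set
  Generated B K = ∀ {y} → y ∈ K → y ∈ B ⊎ TwoNeighboursIn (_∈ K) y

  generated-∪ : ∀ {B S x} → Generated B S → TwoNeighboursIn (_∈ S) x → Generated B (S ∪ ⁅ x ⁆)
  generated-∪ {S = S} {x} gen two y∈ with x∈p∪q⁻ S ⁅ x ⁆ y∈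
  ... | inj₁ y∈S   = map₂ (twoNeighboursIn-mono (p⊆p∪q ⁅ x ⁆)) (gen y∈S)
  ... | inj₂ y∈⁅x⁆ rewrite x∈⁅y⁆⇒x≡y x y∈⁅x⁆ = inj₂ (twoNeighboursIn-mono (p⊆p∪q ⁅ x ⁆) two)

  record Hull (B : Subset n) : Set where
    field
      carrier    : Subset n
      generators : B ⊆ carrier
      convex     : Convex G carrier
      generated  : Generated B carrier

  hull-from : ∀ {B} S → Acc _⊃_ S → B ⊆ S → Generated B S → Hull B
  hull-from S (acc smaller) B⊆S gen with any? (λ x → ¬? (x ∈? S) ×-dec twoNeighboursIn? (_∈? S) x)
  ... | yes (x , x∉S , two) =
    hull-from (S ∪ ⁅ x ⁆) (smaller S⊂S∪⁅x⁆) (⊆-trans B⊆S (p⊆p∪q ⁅ x ⁆)) (generated-∪ gen two)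
    where
    S⊂S∪⁅x⁆ : S ⊂ S ∪ ⁅ x ⁆
    S⊂S∪⁅x⁆ = p⊆p∪q ⁅ x ⁆ , x , q⊆p∪q S ⁅ x ⁆ (x∈⁅x⁆ x) , x∉S
  ... | no none = record { carrier = S ; generators = B⊆S ; convex = convex⁺ closed ; generated = gen }
    where
    closed : ∀ {x} → TwoNeighboursIn (_∈ S) x → x ∈ S
    closed {x} two = decidable-stable (x ∈? S) (λ x∉S → none (x , x∉S , two))

  hull : ∀ B → Hull B
  hull B = hull-from B (⊃-wellFounded B) id inj₁

  generated⊆convex : ConvexGeometry G → ∀ {B C} → Convex G C → Generated C B → B ⊆ C
  generated⊆convex cg {B} {C} convC genB = minimal C convC ext⊆C ∘ generators
    where
    open Hull (hull B)
    minimal : ∀ C → Convex G C → (∀ x → Ext G carrier x → x ∈ C) → carrier ⊆ C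
    minimal = proj₂ (proj₂ (cg carrier convex))
    ext⊆C : ∀ y → Ext G carrier y → y ∈ C
    ext⊆C y ext with generated (proj₁ ext)
    ... | inj₂ two = ⊥-elim (ext⁻ ext two)
    ... | inj₁ y∈B = [ id , ⊥-elim ∘ ext⁻ ext ∘ twoNeighboursIn-mono generators ] (genB y∈B)

  generatedList⊆convex : ConvexGeometry G → ∀ {C} → Convex G C → (xs : List (Fin n)) →
                         All (λ x → x ∈ C ⊎ TwoNeighboursIn (_∈ₗ xs) x) xs → All (_∈ C) xs
  generatedList⊆convex cg {C} convC xs gens =
    All.tabulate (generated⊆convex cg convC generatedC ∘ ∈-fromList⁺)
    where
    generatedC : Generated C (fromList xs)
    generatedC y∈ = map₂ (twoNeighboursIn-mono ∈-fromList⁺) (All.lookup gens (∈-fromList⁻ xs y∈))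

  ∅-convex : Convex G ∅
  ∅-convex = convex⁺ λ (_ , _ , _ , _ , _ , p∈∅ , _) → ⊥-elim (∉⊥ p∈∅)

  no-2-core : ConvexGeometry G → ∀ {x xs} → ¬ All (TwoNeighboursIn (_∈ₗ x ∷ xs)) (x ∷ xs)
  no-2-core cg {x} {xs} twos =
    ∉⊥ (All.head (generatedList⊆convex cg ∅-convex (x ∷ xs) (All.map inj₂ twos)))

  no-triangle : ConvexGeometry G → ∀ {x y z} → Adj G x y → Adj G y z → Adj G z x → ⊥
  no-triangle cg {x} {y} {z} xy yz zx = no-2-core cg
    ( (y , z , adj⇒≢ yz , xy , sym G zx , ∈-lookup (# 1) , ∈-lookup (# 2))
    ∷ (z , x , adj⇒≢ zx , yz , sym G xy , ∈-lookup (# 2) , ∈-lookup (# 0))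
    ∷ (x , y , adj⇒≢ xy , zx , sym G yz , ∈-lookup (# 0) , ∈-lookup (# 1))
    ∷ [])

  pair-convex : ∀ {a b} → ¬ (∃ λ z → Adj G a z × Adj G z b) → Convex G (fromList (a ∷ b ∷ []))
  pair-convex {a} {b} no-common = convex⁺ closed
    where
    closed : ∀ {x} → TwoNeighboursIn (_∈ fromList (a ∷ b ∷ [])) x → x ∈ fromList (a ∷ b ∷ [])
    closed {x} (p , q , p≢q , xp , xq , p∈ , q∈)
      with ∈-fromList⁻ (a ∷ b ∷ []) p∈ | ∈-fromList⁻ (a ∷ b ∷ []) q∈
    ... | here refl         | here refl         = ⊥-elim (p≢q refl)
    ... | here refl         | there (here refl) = ⊥-elim (no-common (x , sym G xp , xq))
    ... | there (here refl) | here refl         = ⊥-elim (no-common (x , sym G xq , xp))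
    ... | there (here refl) | there (here refl) = ⊥-elim (p≢q refl)

  walk₃-ends-have-common-neighbour : ConvexGeometry G → ∀ {a u w b} →
    Adj G a u → Adj G u w → Adj G w b → a ≢ w → u ≢ b → ∃ λ z → Adj G a z × Adj G z b
  walk₃-ends-have-common-neighbour cg {a} {u} {w} {b} au uw wb a≢w u≢b =
    decidable-stable (any? λ z → adj-dec a z ×-dec adj-dec z b) λ no-common →
      u∉ends (All.lookup (generatedList⊆convex cg (pair-convex no-common) walk gens) (∈-lookup (# 1)))
    where
    ends walk : List (Fin n)
    ends = a ∷ b ∷ []
    walk = a ∷ u ∷ w ∷ b ∷ []
    gens : All (λ x → x ∈ fromList ends ⊎ TwoNeighboursIn (_∈ₗ walk) x) walk
    gens = inj₁ (∈-fromList⁺ {xs = ends} (∈-lookup (# 0)))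
         ∷ inj₂ (a , w , a≢w , sym G au , uw , ∈-lookup (# 0) , ∈-lookup (# 2))
         ∷ inj₂ (u , b , u≢b , sym G uw , wb , ∈-lookup (# 1) , ∈-lookup (# 3))
         ∷ inj₁ (∈-fromList⁺ {xs = ends} (∈-lookup (# 1)))
         ∷ []
    u∉ends : u ∉ fromList ends
    u∉ends u∈ with ∈-fromList⁻ ends u∈
    ... | here u≡a         = adj⇒≢ au (≡.sym u≡a)
    ... | there (here u≡b) = u≢b u≡b

  no-nonbacktracking-walk₃ : ConvexGeometry G → ∀ {a u w b} →
                             Adj G a u → Adj G u w → Adj G w b → a ≢ w → u ≢ b → ⊥
  no-nonbacktracking-walk₃ cg {a} {u} {w} {b} au uw wb a≢w u≢b
    with walk₃-ends-have-common-neighbour cg au uw wb a≢w u≢b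
  ... | z , az , zb with a ≟ b | z ≟ u | z ≟ w
  ... | yes refl | _        | _        = no-triangle cg au uw wb
  ... | no _     | yes refl | _        = no-triangle cg uw wb (sym G zb)
  ... | no _     | no _     | yes refl = no-triangle cg au uw (sym G az)
  ... | no a≢b   | no z≢u   | no z≢w   = no-2-core cg
    ( (u , z , ≢-sym z≢u , au , az , ∈-lookup (# 1) , ∈-lookup (# 4))
    ∷ (a , w , a≢w , sym G au , uw , ∈-lookup (# 0) , ∈-lookup (# 2))
    ∷ (u , b , u≢b , sym G uw , wb , ∈-lookup (# 1) , ∈-lookup (# 3))
    ∷ (w , z , ≢-sym z≢w , sym G wb , sym G zb , ∈-lookup (# 2) , ∈-lookup (# 4))
    ∷ (a , b , a≢b , sym G az , zb , ∈-lookup (# 0) , ∈-lookup (# 3))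
    ∷ [])

  Leaf : Fin n → Fin n → Set
  Leaf x y = ∀ z → Adj G x z → z ≡ y

  EveryEdgeHasLeaf : Set
  EveryEdgeHasLeaf = ∀ {u w} → Adj G u w → Leaf u w ⊎ Leaf w u

  leaf⇒¬twoNeighboursIn : ∀ {P x y} → Leaf x y → ¬ TwoNeighboursIn P x
  leaf⇒¬twoNeighboursIn leaf (p , q , p≢q , xp , xq , _) = p≢q (trans (leaf p xp) (≡.sym (leaf q xq)))

  convexGeometry⇒everyEdgeHasLeaf : ConvexGeometry G → EveryEdgeHasLeaf
  convexGeometry⇒everyEdgeHasLeaf cg {u} {w} uw with any? (λ a → adj-dec u a ×-dec ¬? (a ≟ w))
  ... | no ∄a = inj₁ λ p up → decidable-stable (p ≟ w) λ p≢w → ∄a (p , up , p≢w)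
  ... | yes (a , ua , a≢w) = inj₂ λ q wq →
    decidable-stable (q ≟ u) λ q≢u → no-nonbacktracking-walk₃ cg (sym G ua) uw wq a≢w (≢-sym q≢u)

  everyEdgeHasLeaf⇒convexGeometry : EveryEdgeHasLeaf → ConvexGeometry G
  everyEdgeHasLeaf⇒convexGeometry leafy S convS = (λ _ → proj₁) , convS , minimal
    where
    minimal : ∀ C → Convex G C → (∀ x → Ext G S x → x ∈ C) → S ⊆ C
    minimal C convC ext⊆C {x} x∈S with twoNeighboursIn? (_∈? S) x
    ... | no ¬two = ext⊆C x (ext⁺ convS x∈S ¬two)
    ... | yes two@(p , q , p≢q , xp , xq , p∈S , q∈S) =
      convex⁻ convC (p , q , p≢q , xp , xq , extreme xp p∈S , extreme xq q∈S)
      where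
      extreme : ∀ {y} → Adj G x y → y ∈ S → y ∈ C
      extreme {y} xy y∈S with leafy xy
      ... | inj₁ x-leaf = ⊥-elim (leaf⇒¬twoNeighboursIn x-leaf two)
      ... | inj₂ y-leaf = ext⊆C y (ext⁺ convS y∈S (leaf⇒¬twoNeighboursIn y-leaf))

  forestOfStars⇒everyEdgeHasLeaf : ForestOfStars G → EveryEdgeHasLeaf
  forestOfStars⇒everyEdgeHasLeaf fos {u} {w} uw with fos u
  ... | c , _ , _ , touches-c =
    [ inj₂ ∘ leaf-off-centre (uw ◅ ε) (sym G uw) , inj₁ ∘ leaf-off-centre ε uw ] (touches-c u w ε uw)
    where
    leaf-off-centre : ∀ {x y} → Connected G u x → Adj G x y → y ≡ c → Leaf x y
    leaf-off-centre ux xy y≡c z xz with touches-c _ z ux xz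
    ... | inj₁ x≡c = ⊥-elim (adj⇒≢ xy (trans x≡c (≡.sym y≡c)))
    ... | inj₂ z≡c = trans z≡c (≡.sym y≡c)

  IsCentre : Fin n → Set
  IsCentre c = ∀ {u} → Adj G c u → Leaf u c

  centre-of-leaf : EveryEdgeHasLeaf → ∀ {c ℓ} → Adj G c ℓ → Leaf ℓ c → IsCentre c
  centre-of-leaf leafy {c} {ℓ} cℓ ℓ-leaf {u} cu with leafy cu
  ... | inj₁ c-leaf = subst (λ v → Leaf v c) (c-leaf ℓ cℓ) ℓ-leaf
  ... | inj₂ u-leaf = u-leaf

  respects-Connected : ∀ {P : Fin n → Set} → P Respects Adj G → P Respects Connected G
  respects-Connected step ε        = id
  respects-Connected step (e ◅ es) = respects-Connected step es ∘ step e

  InStar : Fin n → Fin n → Set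
  InStar c u = u ≡ c ⊎ Adj G c u

  inStar-respects : ∀ {c} → IsCentre c → InStar c Respects Adj G
  inStar-respects centre uw (inj₁ refl) = inj₂ uw
  inStar-respects centre uw (inj₂ cu)   = inj₁ (centre cu _ uw)

  star-component : ∀ {c v} → IsCentre c → InStar c v →
    Connected G v c × (∀ u → Connected G v u → InStar c u) ×
    (∀ u w → Connected G v u → Adj G u w → u ≡ c ⊎ w ≡ c)
  star-component {c} {v} centre v∈ =
    v⇝c v∈ , in-star , λ u w vu uw → map₂ (λ cu → centre cu w uw) (in-star u vu)
    where
    v⇝c : ∀ {x} → InStar c x → Connected G x c
    v⇝c (inj₁ refl) = ε
    v⇝c (inj₂ cv)   = sym G cv ◅ ε
    in-star : ∀ u → Connected G v u → InStar c u
    in-star u vu = respects-Connected (inStar-respects centre) vu v∈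

  everyEdgeHasLeaf⇒forestOfStars : EveryEdgeHasLeaf → ForestOfStars G
  everyEdgeHasLeaf⇒forestOfStars leafy v with any? (adj-dec v)
  ... | no isolated = v , star-component (λ vu → ⊥-elim (isolated (_ , vu))) (inj₁ refl)
  ... | yes (x , vx) with leafy vx
  ...   | inj₁ v-leaf = x , star-component (centre-of-leaf leafy (sym G vx) v-leaf) (inj₂ (sym G vx))
  ...   | inj₂ x-leaf = v , star-component (centre-of-leaf leafy vx x-leaf) (inj₁ refl)

mainTheorem1 : ∀ (n : ℕ) (G : Graph n) →
    (ConvexGeometry G → ForestOfStars G) × (ForestOfStars G → ConvexGeometry G)
mainTheorem1 n G = everyEdgeHasLeaf⇒forestOfStars G ∘ convexGeometry⇒everyEdgeHasLeaf G
                 , everyEdgeHasLeaf⇒convexGeometry G ∘ forestOfStars⇒everyEdgeHasLeaf G
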